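{- Let $F^T=\begin{bmatrix}1&0\\0&1\\0&1\end{bmatrix}$ and let $A$ be a simple $(0,1)$-matrix with $F^T\not\prec A$ and $I_2\prec A$. Then, after permuting rows and columns, $A=\begin{bmatrix}A_1&0&0\\1&B&0\\1&1&A_2\end{bmatrix}$, where each $0$ (resp. $1$) denotes an all-zero (resp. all-one) block of the appropriate size, $A_1$ and $A_2$ are simple matrices with $F^T\not\prec A_1$ and $F^T\not\prec A_2$ (some blocks may have no rows or no columns), and $B=I_l$ or $B=I_l^c$ for some $l\ge2$.
   Context: A $(0,1)$-matrix is simple if it has no repeated columns. $F\prec A$ means some submatrix of $A$ is a row and column permutation of $F$. $I_l$ is the $l\times l$ identity matrix and $I_l^c$ its $(0,1)$-complement. -}

module Defs where

open import Data.Nat using (ℕ; _+_)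
open import Data.Fin using (Fin; zero; suc; splitAt; _≟_)
open import Data.Bool using (Bool; true; false; not)
open import Data.Sum using (_⊎_; inj₁; inj₂)
open import Data.Product using (Σ; _×_; _,_)
open import Relation.Binary.PropositionalEquality using (_≡_)
open import Relation.Nullary using (¬_)
open import Relation.Nullary.Decidable using (⌊_⌋)
open import Function.Definitions using (Injective)

Mat : ℕ → ℕ → Set
Mat m n = Fin m → Fin n → Bool

Simple : ∀ {m n} → Mat m n → Set
Simple {m} {n} A = ∀ (j j′ : Fin n) → (∀ (i : Fin m) → A i j ≡ A i j′) → j ≡ j′

-- F ≺ A : some submatrix of A is a row and column permutation of F,
-- i.e. there are injective maps of the rows and columns of F into
-- those of A under which the entries agree.
_≺_ : ∀ {p q m n} → Mat p q → Mat m n → Set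
_≺_ {p} {q} {m} {n} F A =
  Σ (Fin p → Fin m) λ f → Σ (Fin q → Fin n) λ g →
    Injective _≡_ _≡_ f × Injective _≡_ _≡_ g ×
    (∀ i j → A (f i) (g j) ≡ F i j)

I : (l : ℕ) → Mat l l
I l i j = ⌊ i ≟ j ⌋

Ic : (l : ℕ) → Mat l l
Ic l i j = not (I l i j)

FT : Mat 3 2
FT zero          zero       = true
FT zero          (suc zero) = false
FT (suc _)       zero       = false
FT (suc _)       (suc zero) = true

split3 : ∀ a b c → Fin (a + b + c) → Fin a ⊎ (Fin b ⊎ Fin c)
split3 a b c k with splitAt (a + b) k
... | inj₂ z = inj₂ (inj₂ z)
... | inj₁ xy with splitAt a xy
...   | inj₁ x = inj₁ x
...   | inj₂ y = inj₂ (inj₁ y)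

block : ∀ {r₁ c₁ l r₃ c₃} → Mat r₁ c₁ → Mat l l → Mat r₃ c₃ →
        Mat (r₁ + l + r₃) (c₁ + l + c₃)
block {r₁} {c₁} {l} {r₃} {c₃} A₁ B A₂ i j with split3 r₁ l r₃ i | split3 c₁ l c₃ j
... | inj₁ x        | inj₁ y        = A₁ x y
... | inj₁ _        | inj₂ _        = false
... | inj₂ (inj₁ _) | inj₁ _        = true
... | inj₂ (inj₁ x) | inj₂ (inj₁ y) = B x y
... | inj₂ (inj₁ _) | inj₂ (inj₂ _) = false
... | inj₂ (inj₂ _) | inj₁ _        = true
... | inj₂ (inj₂ _) | inj₂ (inj₁ _) = true
... | inj₂ (inj₂ x) | inj₂ (inj₂ y) = A₂ x y

{-# OPTIONS --safe #-}
-- Let columns c, d and rows x, y carry a copy of I₂, and call a column e ≠ c middle when on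
-- (c , e) some row reads (1 , 0) and another reads (0 , 1). Forbidding Fᵀ means that each of
-- these two patterns then occurs in exactly one row, so a middle column is c with two entries
-- flipped, and two middle columns always share one of their flip rows. As d is middle, either
-- x is the (1 , 0) row of every middle column or y is the (0 , 1) row of every one. Pairing c
-- with that common row and every other middle column with its remaining flip row gives the
-- middle block I or Iᶜ. Every other column differs from c in one direction only, i.e. contains
-- c or is contained in it, and goes left or right of the middle block; every other row agrees
-- with c on the middle columns and goes above or below it according to its entry in c.
module Submission where

open import Defs
open import Data.Nat using (ℕ; _≤_; _+_; zero; suc; s≤s; z≤n)
open import Data.Product using (Σ; _×_; _,_; ∃; proj₁; proj₂)
open import Data.Sum using (_⊎_; inj₁; inj₂; [_,_]′)
open import Data.Sum.Properties using (inj₁-injective; inj₂-injective)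
open import Data.Bool using (Bool; true; false; not)
open import Data.Bool.Properties using (not-involutive; not-¬; ¬-not) renaming (_≟_ to _≟ᵇ_)
open import Data.Fin using (Fin; zero; suc; splitAt; _↑ˡ_; _↑ʳ_; _≟_)
open import Data.Fin.Properties using (any?; suc-injective; splitAt-↑ˡ; splitAt-↑ʳ; splitAt⁻¹-↑ˡ; splitAt⁻¹-↑ʳ)
open import Data.Fin.Permutation using (Permutation; _⟨$⟩ʳ_)
open import Data.Vec.Functional using (_∷_)
open import Function using (_∘_)
open import Function.Bundles using (_↔_; Inverse; Injection; mk↔ₛ′)
open import Function.Construct.Composition using (_↔-∘_)
open import Function.Definitions using (Injective)
open import Function.Properties.Inverse using (↔⇒↣)
open import Relation.Binary.PropositionalEquality using (_≡_; _≢_; refl; sym; trans; cong; subst; ≢-sym)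
open import Relation.Nullary using (¬_; Dec; yes; no; contradiction)
open import Relation.Nullary.Decidable using (_×-dec_; _⊎-dec_; ¬?; dec-true; dec-false; decidable-stable; isYes≗does)
open import Relation.Unary using (Decidable)

-- Partitions of Fin n into three blocks

record Enumeration {n} (P : Fin n → Set) : Set where
  field
    size      : ℕ
    at        : Fin size → Fin n
    injective : Injective _≡_ _≡_ at
    sound     : ∀ i → P (at i)
    complete  : ∀ j → P j → ∃ λ i → at i ≡ j

module _ {n} {P : Fin (suc n) → Set} (E : Enumeration (P ∘ suc)) where
  open Enumeration E

  skip-zero : ¬ P zero → Enumeration P
  skip-zero ¬p₀ = record
    { size = size ; at = suc ∘ at ; injective = injective ∘ suc-injective
    ; sound = sound ; complete = complete′ }
    where
      complete′ : ∀ j → P j → ∃ λ i → suc (at i) ≡ j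
      complete′ zero    p₀ = contradiction p₀ ¬p₀
      complete′ (suc j) p  = let i , eq = complete j p in i , cong suc eq

  keep-zero : P zero → Enumeration P
  keep-zero p₀ = record
    { size = suc size ; at = zero ∷ suc ∘ at ; injective = injective′
    ; sound = sound′ ; complete = complete′ }
    where
      injective′ : Injective _≡_ _≡_ (zero ∷ suc ∘ at)
      injective′ {zero}  {zero}  _  = refl
      injective′ {suc i} {suc j} eq = cong suc (injective (suc-injective eq))
      sound′ : ∀ i → P ((zero ∷ suc ∘ at) i)
      sound′ zero    = p₀
      sound′ (suc i) = sound i
      complete′ : ∀ j → P j → ∃ λ i → (zero ∷ suc ∘ at) i ≡ j
      complete′ zero    _ = zero , refl
      complete′ (suc j) p = let i , eq = complete j p in suc i , cong suc eq

enumerate : ∀ {n} {P : Fin n → Set} → Decidable P → Enumeration P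
enumerate {zero} _ = record
  { size = 0 ; at = λ () ; injective = λ { {()} } ; sound = λ () ; complete = λ () }
enumerate {suc n} P? with P? zero
... | yes p₀ = keep-zero (enumerate (P? ∘ suc)) p₀
... | no ¬p₀ = skip-zero (enumerate (P? ∘ suc)) ¬p₀

join3 : ∀ a b c → Fin a ⊎ (Fin b ⊎ Fin c) → Fin (a + b + c)
join3 a b c (inj₁ x)        = (x ↑ˡ b) ↑ˡ c
join3 a b c (inj₂ (inj₁ y)) = (a ↑ʳ y) ↑ˡ c
join3 a b c (inj₂ (inj₂ z)) = (a + b) ↑ʳ z

split3-join3 : ∀ a b c s → split3 a b c (join3 a b c s) ≡ s
split3-join3 a b c (inj₁ x)
  rewrite splitAt-↑ˡ (a + b) (x ↑ˡ b) c | splitAt-↑ˡ a x b = refl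
split3-join3 a b c (inj₂ (inj₁ y))
  rewrite splitAt-↑ˡ (a + b) (a ↑ʳ y) c | splitAt-↑ʳ a b y = refl
split3-join3 a b c (inj₂ (inj₂ z))
  rewrite splitAt-↑ʳ (a + b) c z = refl

join3-split3 : ∀ a b c k → join3 a b c (split3 a b c k) ≡ k
join3-split3 a b c k with splitAt (a + b) k in eq
... | inj₂ z = splitAt⁻¹-↑ʳ eq
... | inj₁ xy with splitAt a xy in eq′
...   | inj₁ x = trans (cong (_↑ˡ c) (splitAt⁻¹-↑ˡ eq′)) (splitAt⁻¹-↑ˡ eq)
...   | inj₂ y = trans (cong (_↑ˡ c) (splitAt⁻¹-↑ʳ eq′)) (splitAt⁻¹-↑ˡ eq)

split3↔ : ∀ a b c → Fin (a + b + c) ↔ (Fin a ⊎ (Fin b ⊎ Fin c))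
split3↔ a b c = mk↔ₛ′ (split3 a b c) (join3 a b c) (split3-join3 a b c) (join3-split3 a b c)

module _ {n} {P Q R : Fin n → Set} (EP : Enumeration P) (EQ : Enumeration Q) (ER : Enumeration R)
         (P∩Q=∅ : ∀ {j} → P j → ¬ Q j) (P∩R=∅ : ∀ {j} → P j → ¬ R j) (Q∩R=∅ : ∀ {j} → Q j → ¬ R j)
         (cover : ∀ j → P j ⊎ Q j ⊎ R j) where
  private
    module EP = Enumeration EP
    module EQ = Enumeration EQ
    module ER = Enumeration ER

    Blocks : Set
    Blocks = Fin EP.size ⊎ (Fin EQ.size ⊎ Fin ER.size)

    embed : Blocks → Fin n
    embed = [ EP.at , [ EQ.at , ER.at ]′ ]′

    locate : ∀ {j} → P j ⊎ Q j ⊎ R j → Blocks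
    locate (inj₁ p)        = inj₁ (proj₁ (EP.complete _ p))
    locate (inj₂ (inj₁ q)) = inj₂ (inj₁ (proj₁ (EQ.complete _ q)))
    locate (inj₂ (inj₂ r)) = inj₂ (inj₂ (proj₁ (ER.complete _ r)))

    embed-locate : ∀ {j} (w : P j ⊎ Q j ⊎ R j) → embed (locate w) ≡ j
    embed-locate (inj₁ p)        = proj₂ (EP.complete _ p)
    embed-locate (inj₂ (inj₁ q)) = proj₂ (EQ.complete _ q)
    embed-locate (inj₂ (inj₂ r)) = proj₂ (ER.complete _ r)

    locate-embed : ∀ s → locate (cover (embed s)) ≡ s
    locate-embed (inj₁ i) with cover (EP.at i)
    ... | inj₁ p        = cong inj₁ (EP.injective (proj₂ (EP.complete _ p)))
    ... | inj₂ (inj₁ q) = contradiction q (P∩Q=∅ (EP.sound i))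
    ... | inj₂ (inj₂ r) = contradiction r (P∩R=∅ (EP.sound i))
    locate-embed (inj₂ (inj₁ i)) with cover (EQ.at i)
    ... | inj₁ p        = contradiction (EQ.sound i) (P∩Q=∅ p)
    ... | inj₂ (inj₁ q) = cong (inj₂ ∘ inj₁) (EQ.injective (proj₂ (EQ.complete _ q)))
    ... | inj₂ (inj₂ r) = contradiction r (Q∩R=∅ (EQ.sound i))
    locate-embed (inj₂ (inj₂ i)) with cover (ER.at i)
    ... | inj₁ p        = contradiction (ER.sound i) (P∩R=∅ p)
    ... | inj₂ (inj₁ q) = contradiction (ER.sound i) (Q∩R=∅ q)
    ... | inj₂ (inj₂ r) = cong (inj₂ ∘ inj₂) (ER.injective (proj₂ (ER.complete _ r)))

  partition↔ : (Fin EP.size ⊎ (Fin EQ.size ⊎ Fin ER.size)) ↔ Fin n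
  partition↔ = mk↔ₛ′ embed (locate ∘ cover) (embed-locate ∘ cover) locate-embed

-- Submatrices and the block form

submatrix : ∀ {m n p q} → Mat m n → (Fin p → Fin m) → (Fin q → Fin n) → Mat p q
submatrix A f g i j = A (f i) (g j)

≺-submatrix : ∀ {m n p q k l} {A : Mat m n} {F : Mat k l} {f : Fin p → Fin m} {g : Fin q → Fin n} →
              Injective _≡_ _≡_ f → Injective _≡_ _≡_ g → F ≺ submatrix A f g → F ≺ A
≺-submatrix {f = f} {g = g} f-inj g-inj (f′ , g′ , f′-inj , g′-inj , entries) =
  f ∘ f′ , g ∘ g′ , f′-inj ∘ f-inj , g′-inj ∘ g-inj , entries

submatrix-simple : ∀ {m n p q} {A : Mat m n} {f : Fin p → Fin m} {g : Fin q → Fin n} →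
  Simple A → Injective _≡_ _≡_ g →
  (∀ r → (∃ λ i → f i ≡ r) ⊎ (∀ j j′ → A r (g j) ≡ A r (g j′))) → Simple (submatrix A f g)
submatrix-simple {A = A} {f} {g} simple g-inj rows j j′ same = g-inj (simple _ _ agree)
  where
    agree : ∀ r → A r (g j) ≡ A r (g j′)
    agree r with rows r
    ... | inj₁ (i , refl) = same i
    ... | inj₂ constant   = constant j j′

BlockForm : ∀ {m n} → Mat m n → Set
BlockForm {m} {n} A =
    Σ ℕ λ r₁ → Σ ℕ λ c₁ → Σ ℕ λ l → Σ ℕ λ r₃ → Σ ℕ λ c₃ →
    Σ (Mat r₁ c₁) λ A₁ → Σ (Mat l l) λ B → Σ (Mat r₃ c₃) λ A₂ →
    Σ (Permutation (r₁ + l + r₃) m) λ σ →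
    Σ (Permutation (c₁ + l + c₃) n) λ τ →
    (∀ i j → A (σ ⟨$⟩ʳ i) (τ ⟨$⟩ʳ j) ≡ block A₁ B A₂ i j) ×
    Simple A₁ × ¬ (FT ≺ A₁) × Simple A₂ × ¬ (FT ≺ A₂) ×
    (B ≡ I l ⊎ B ≡ Ic l) × 2 ≤ l

≢⇒2≤ : ∀ {l} (i j : Fin l) → i ≢ j → 2 ≤ l
≢⇒2≤ {suc zero}    zero zero i≢j = contradiction refl i≢j
≢⇒2≤ {suc (suc l)} _    _    _   = s≤s (s≤s z≤n)

I-or-Ic : Bool → (l : ℕ) → Mat l l
I-or-Ic true  = I
I-or-Ic false = Ic

I-or-Ic-shape : ∀ t l → I-or-Ic t l ≡ I l ⊎ I-or-Ic t l ≡ Ic l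
I-or-Ic-shape true  _ = inj₁ refl
I-or-Ic-shape false _ = inj₂ refl

I-or-Ic-diagonal : ∀ t {l} (i : Fin l) → I-or-Ic t l i i ≡ t
I-or-Ic-diagonal true  i = trans (isYes≗does (i ≟ i)) (dec-true (i ≟ i) refl)
I-or-Ic-diagonal false i = cong not (I-or-Ic-diagonal true i)

I-or-Ic-off-diagonal : ∀ t {l} {i j : Fin l} → i ≢ j → I-or-Ic t l i j ≡ not t
I-or-Ic-off-diagonal true  {i = i} {j} i≢j = trans (isYes≗does (i ≟ j)) (dec-false (i ≟ j) i≢j)
I-or-Ic-off-diagonal false i≢j = cong not (I-or-Ic-off-diagonal true i≢j)

module _ {m n} {A : Mat m n} (simple : Simple A) (FT⊀A : ¬ FT ≺ A) {r₁ l r₃ c₁ c₃}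
         (ρ : (Fin r₁ ⊎ (Fin l ⊎ Fin r₃)) ↔ Fin m) (γ : (Fin c₁ ⊎ (Fin l ⊎ Fin c₃)) ↔ Fin n) where
  private
    module ρ = Inverse ρ
    module γ = Inverse γ

    top : Fin r₁ → Fin m
    top = ρ.to ∘ inj₁
    middle : Fin l → Fin m
    middle = ρ.to ∘ inj₂ ∘ inj₁
    bottom : Fin r₃ → Fin m
    bottom = ρ.to ∘ inj₂ ∘ inj₂
    left : Fin c₁ → Fin n
    left = γ.to ∘ inj₁
    centre : Fin l → Fin n
    centre = γ.to ∘ inj₂ ∘ inj₁
    right : Fin c₃ → Fin n
    right = γ.to ∘ inj₂ ∘ inj₂

    ρ-injective : Injective _≡_ _≡_ ρ.to
    ρ-injective = Injection.injective (↔⇒↣ ρ)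
    γ-injective : Injective _≡_ _≡_ γ.to
    γ-injective = Injection.injective (↔⇒↣ γ)

    row-cases : ∀ r → (∃ λ i → top i ≡ r) ⊎ (∃ λ i → middle i ≡ r) ⊎ (∃ λ i → bottom i ≡ r)
    row-cases r with ρ.from r | ρ.strictlyInverseˡ r
    ... | inj₁ i        | eq = inj₁ (i , eq)
    ... | inj₂ (inj₁ i) | eq = inj₂ (inj₁ (i , eq))
    ... | inj₂ (inj₂ i) | eq = inj₂ (inj₂ (i , eq))

  blockForm-of-partitions : (B : Mat l l) → B ≡ I l ⊎ B ≡ Ic l → 2 ≤ l →
    (∀ i j → A (middle i) (centre j) ≡ B i j) →
    (∀ i j → A (top i) (centre j) ≡ false) → (∀ i j → A (top i) (right j) ≡ false) →
    (∀ i j → A (middle i) (left j) ≡ true) → (∀ i j → A (middle i) (right j) ≡ false) →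
    (∀ i j → A (bottom i) (left j) ≡ true) → (∀ i j → A (bottom i) (centre j) ≡ true) →
    BlockForm A
  blockForm-of-partitions B B-shape 2≤l mid top-centre top-right mid-left mid-right bot-left bot-centre =
    r₁ , c₁ , l , r₃ , c₃ , A₁ , B , A₂ , ρ ↔-∘ split3↔ r₁ l r₃ , γ ↔-∘ split3↔ c₁ l c₃ ,
    entries , simple₁ , FT⊀A₁ , simple₂ , FT⊀A₂ , B-shape , 2≤l
    where
      A₁ : Mat r₁ c₁
      A₁ = submatrix A top left
      A₂ : Mat r₃ c₃
      A₂ = submatrix A bottom right

      entries : ∀ i j → A (ρ.to (split3 r₁ l r₃ i)) (γ.to (split3 c₁ l c₃ j)) ≡ block A₁ B A₂ i j
      entries i j with split3 r₁ l r₃ i | split3 c₁ l c₃ j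
      ... | inj₁ a        | inj₁ b        = refl
      ... | inj₁ a        | inj₂ (inj₁ b) = top-centre a b
      ... | inj₁ a        | inj₂ (inj₂ b) = top-right a b
      ... | inj₂ (inj₁ a) | inj₁ b        = mid-left a b
      ... | inj₂ (inj₁ a) | inj₂ (inj₁ b) = mid a b
      ... | inj₂ (inj₁ a) | inj₂ (inj₂ b) = mid-right a b
      ... | inj₂ (inj₂ a) | inj₁ b        = bot-left a b
      ... | inj₂ (inj₂ a) | inj₂ (inj₁ b) = bot-centre a b
      ... | inj₂ (inj₂ a) | inj₂ (inj₂ b) = refl

      row-constant : ∀ {k p} {rows : Fin k → Fin m} {cols : Fin p → Fin n} {v} →
                 (∀ i j → A (rows i) (cols j) ≡ v) →
                 ∀ {r} → (∃ λ i → rows i ≡ r) → ∀ j j′ → A r (cols j) ≡ A r (cols j′)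
      row-constant entry (i , refl) j j′ = trans (entry i j) (sym (entry i j′))

      simple₁ : Simple A₁
      simple₁ = submatrix-simple simple (inj₁-injective ∘ γ-injective) λ r →
        [ inj₁ , inj₂ ∘ [ row-constant mid-left , row-constant bot-left ]′ ]′ (row-cases r)

      simple₂ : Simple A₂
      simple₂ = submatrix-simple simple (inj₂-injective ∘ inj₂-injective ∘ γ-injective) λ r →
        [ inj₂ ∘ row-constant top-right , [ inj₂ ∘ row-constant mid-right , inj₁ ]′ ]′ (row-cases r)

      FT⊀A₁ : ¬ FT ≺ A₁
      FT⊀A₁ = FT⊀A ∘ ≺-submatrix {A = A} (inj₁-injective ∘ ρ-injective) (inj₁-injective ∘ γ-injective)

      FT⊀A₂ : ¬ FT ≺ A₂
      FT⊀A₂ = FT⊀A ∘ ≺-submatrix {A = A} (inj₂-injective ∘ inj₂-injective ∘ ρ-injective)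
                                  (inj₂-injective ∘ inj₂-injective ∘ γ-injective)

Splits : ∀ {m n} → Mat m n → Bool → Fin m → Fin n → Fin n → Set
Splits A t r u v = A r u ≡ t × A r v ≡ not t

rows-≢ : ∀ {m n} (A : Mat m n) {r s u t} → A r u ≡ t → A s u ≡ not t → r ≢ s
rows-≢ _ ru su refl = not-¬ refl (trans (sym ru) su)

cols-≢ : ∀ {m n} (A : Mat m n) {r u v t} → A r u ≡ t → A r v ≡ not t → u ≢ v
cols-≢ _ ru rv refl = not-¬ refl (trans (sym ru) rv)

FT⊀⇒splitter-unique : ∀ {m n} {A : Mat m n} → ¬ FT ≺ A → ∀ t {r s s′ u v} →
  Splits A (not t) r u v → Splits A t s u v → Splits A t s′ u v → s ≡ s′
FT⊀⇒splitter-unique {A = A} FT⊀A true (ru , rv) (su , sv) (s′u , s′v) =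
  FT⊀⇒splitter-unique {A = A} FT⊀A false (rv , ru) (sv , su) (s′v , s′u)
FT⊀⇒splitter-unique {m} {n} {A} FT⊀A false {r} {s} {s′} {u} {v} (ru , rv) (su , sv) (s′u , s′v) =
  decidable-stable (s ≟ s′) λ s≢s′ → FT⊀A (rows , cols , rows-injective s≢s′ , cols-injective , entries)
  where
    rows : Fin 3 → Fin m
    rows zero             = r
    rows (suc zero)       = s
    rows (suc (suc zero)) = s′

    cols : Fin 2 → Fin n
    cols zero       = u
    cols (suc zero) = v

    entries : ∀ i j → A (rows i) (cols j) ≡ FT i j
    entries zero             zero       = ru
    entries zero             (suc zero) = rv
    entries (suc zero)       zero       = su
    entries (suc zero)       (suc zero) = sv
    entries (suc (suc zero)) zero       = s′u
    entries (suc (suc zero)) (suc zero) = s′v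

    rows-injective : s ≢ s′ → Injective _≡_ _≡_ rows
    rows-injective _     {zero}             {zero}             _  = refl
    rows-injective _     {zero}             {suc zero}         eq = contradiction eq (rows-≢ A ru su)
    rows-injective _     {zero}             {suc (suc zero)}   eq = contradiction eq (rows-≢ A ru s′u)
    rows-injective _     {suc zero}         {zero}             eq = contradiction (sym eq) (rows-≢ A ru su)
    rows-injective _     {suc zero}         {suc zero}         _  = refl
    rows-injective s≢s′  {suc zero}         {suc (suc zero)}   eq = contradiction eq s≢s′
    rows-injective _     {suc (suc zero)}   {zero}             eq = contradiction (sym eq) (rows-≢ A ru s′u)
    rows-injective s≢s′  {suc (suc zero)}   {suc zero}         eq = contradiction (sym eq) s≢s′
    rows-injective _     {suc (suc zero)}   {suc (suc zero)}   _  = refl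

    cols-injective : Injective _≡_ _≡_ cols
    cols-injective {zero}     {zero}     _  = refl
    cols-injective {zero}     {suc zero} eq = contradiction eq (cols-≢ A ru rv)
    cols-injective {suc zero} {zero}     eq = contradiction (sym eq) (cols-≢ A ru rv)
    cols-injective {suc zero} {suc zero} _  = refl

-- Columns compared with a pivot column

module Pivot {m n} {A : Mat m n} (simple : Simple A) (FT⊀A : ¬ FT ≺ A) (c : Fin n) where

  Flips : Bool → Fin m → Fin n → Set
  Flips t r e = Splits A t r c e

  Flipped : Bool → Fin n → Set
  Flipped t e = ∃ λ r → Flips t r e

  Flipped? : ∀ t e → Dec (Flipped t e)
  Flipped? t e = any? λ r → (A r c ≟ᵇ t) ×-dec (A r e ≟ᵇ not t)

  Mid : Fin n → Set
  Mid e = ∀ t → Flipped t e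

  Mid? : ∀ e → Dec (Mid e)
  Mid? e with Flipped? true e | Flipped? false e
  ... | yes ft | yes ff = yes λ { true → ft ; false → ff }
  ... | no ¬ft | _      = no λ mid → ¬ft (mid true)
  ... | yes _  | no ¬ff = no λ mid → ¬ff (mid false)

  -- OneSided true f means f ⊊ c (right of the middle block), OneSided false f means f ⊋ c
  -- (left of it).
  OneSided : Bool → Fin n → Set
  OneSided t f = Flipped t f × ¬ Flipped (not t) f

  MidCol : Fin n → Set
  MidCol e = Mid e ⊎ e ≡ c

  c-unflipped : ∀ t → ¬ Flipped t c
  c-unflipped t (r , rc , rc′) = not-¬ rc rc′

  flips-at : ∀ {r e} → A r e ≢ A r c → Flips (A r c) r e
  flips-at re≢rc = refl , ¬-not re≢rc

  unflipped : ∀ {t r e} → ¬ Flipped t e → A r c ≡ t → A r e ≡ t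
  unflipped {t} {r} {e} ¬fl rc = decidable-stable (A r e ≟ᵇ t) λ re≢t → ¬fl (r , rc , ¬-not re≢t)

  unflipped⇒≡c : ∀ {e} → ¬ Flipped true e → ¬ Flipped false e → e ≡ c
  unflipped⇒≡c {e} ¬ft ¬ff = simple e c agree
    where
      agree : ∀ r → A r e ≡ A r c
      agree r with A r c in rc
      ... | true  = unflipped ¬ft rc
      ... | false = unflipped ¬ff rc

  flip-unique : ∀ {t r r′ e} → Mid e → Flips t r e → Flips t r′ e → r ≡ r′
  flip-unique {t} mid = FT⊀⇒splitter-unique {A = A} FT⊀A t (proj₂ (mid (not t)))

  flip-rows : ∀ {t s a b r e} → Mid e → Flips t a e → Flips (not t) b e → Flips s r e → r ≡ a ⊎ r ≡ b
  flip-rows {t} {s} {r = r} {e} mid fa fb fr with s ≟ᵇ t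
  ... | yes refl = inj₁ (flip-unique mid fr fa)
  ... | no s≢t   = inj₂ (flip-unique mid (subst (λ s → Flips s r e) (¬-not s≢t) fr) fb)

  agrees-off-flips : ∀ {t a b r e} → Mid e → Flips t a e → Flips (not t) b e → r ≢ a → r ≢ b →
                     A r e ≡ A r c
  agrees-off-flips {r = r} {e} mid fa fb r≢a r≢b =
    decidable-stable (A r e ≟ᵇ A r c) λ re≢rc → [ r≢a , r≢b ]′ (flip-rows mid fa fb (flips-at re≢rc))

  same-flips⇒≡ : ∀ {t a b e e′} → Mid e → Mid e′ → Flips t a e → Flips t a e′ →
                 Flips (not t) b e → Flips (not t) b e′ → e ≡ e′
  same-flips⇒≡ {a = a} {b} {e} {e′} mid mid′ fa fa′ fb fb′ = simple e e′ agree
    where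
      agree : ∀ r → A r e ≡ A r e′
      agree r with r ≟ a | r ≟ b
      ... | yes refl | _        = trans (proj₂ fa) (sym (proj₂ fa′))
      ... | no _     | yes refl = trans (proj₂ fb) (sym (proj₂ fb′))
      ... | no r≢a   | no r≢b   =
        trans (agrees-off-flips mid fa fb r≢a r≢b) (sym (agrees-off-flips mid′ fa′ fb′ r≢a r≢b))

  -- Were the (not t)-flip row b of e not b′, then a′ and b would both read (t , not t)
  -- on (e , e′) while a reads (not t , t).
  flip-row-shared : ∀ {t a a′ b′ e e′} → Mid e → Mid e′ → Flips t a e → Flips t a′ e′ → a ≢ a′ →
                    Flips (not t) b′ e′ → Flips (not t) b′ e
  flip-row-shared {t} {a} {a′} {b′} {e} {e′} mid mid′ fa fa′ a≢a′ fb′ =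
    subst (λ r → Flips (not t) r e) b≡b′ fb
    where
      b : Fin m
      b = proj₁ (mid (not t))
      fb : Flips (not t) b e
      fb = proj₂ (mid (not t))
      a≢b′ : a ≢ b′
      a≢b′ = rows-≢ A (proj₁ fa) (proj₁ fb′)
      a′≢b : a′ ≢ b
      a′≢b = rows-≢ A (proj₁ fa′) (proj₁ fb)

      a-splits : Splits A (not t) a e e′
      a-splits = proj₂ fa , trans (trans (agrees-off-flips mid′ fa′ fb′ a≢a′ a≢b′) (proj₁ fa))
                                  (sym (not-involutive t))
      a′-splits : Splits A t a′ e e′
      a′-splits = trans (agrees-off-flips mid fa fb (≢-sym a≢a′) a′≢b) (proj₁ fa′) , proj₂ fa′
      b-splits : b ≢ b′ → Splits A t b e e′
      b-splits b≢b′ = trans (proj₂ fb) (not-involutive t) ,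
                      trans (agrees-off-flips mid′ fa′ fb′ (≢-sym a′≢b) b≢b′) (proj₁ fb)

      b≡b′ : b ≡ b′
      b≡b′ = decidable-stable (b ≟ b′) λ b≢b′ →
        a′≢b (FT⊀⇒splitter-unique {A = A} FT⊀A t a-splits a′-splits (b-splits b≢b′))

  common-flip-row : ∀ {x y d} → Mid d → Flips true x d → Flips false y d →
                    (∀ {e} → Mid e → Flips true x e) ⊎ (∀ {e} → Mid e → Flips false y e)
  common-flip-row {x} {y} {d} mid-d fx fy with any? (λ e → Mid? e ×-dec (A x e ≟ᵇ true))
  ... | no none = inj₁ λ {e} mid → proj₁ fx , ¬-not λ xe → none (e , mid , xe)
  ... | yes (e* , mid* , xe*) = inj₂ y-flips
    where
      a* : Fin m
      a* = proj₁ (mid* true)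
      fa* : Flips true a* e*
      fa* = proj₂ (mid* true)
      x≢a* : x ≢ a*
      x≢a* = rows-≢ A xe* (proj₂ fa*)
      y-flips* : Flips false y e*
      y-flips* = flip-row-shared mid* mid-d fa* fx (≢-sym x≢a*) fy
      y-flips : ∀ {e} → Mid e → Flips false y e
      y-flips {e} mid with proj₁ (mid true) ≟ x
      ... | yes a≡x = flip-row-shared mid mid* (proj₂ (mid true)) fa* (x≢a* ∘ trans (sym a≡x)) y-flips*
      ... | no a≢x  = flip-row-shared mid mid-d (proj₂ (mid true)) fx a≢x fy

  -- If an s-flip row of e had s in column f, it would read (not s , s) on (e , f), while
  -- the (not s)-flip row of e and an s-flip row of f both read (s , not s).
  one-sided-on-flip-rows : ∀ {s u r e f} → OneSided s f → Mid e → Flips u r e → A r f ≡ not s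
  one-sided-on-flip-rows {s} {u} {r} {e} {f} (fl , ¬fl′) mid fr with u ≟ᵇ s
  ... | no u≢s   = unflipped ¬fl′ (trans (proj₁ fr) (¬-not u≢s))
  ... | yes refl = decidable-stable (A r f ≟ᵇ not s) λ rf≢¬s →
        g≢a (sym (FT⊀⇒splitter-unique {A = A} FT⊀A s (proj₂ fr , ¬-not rf≢¬s) a-splits (g-splits rf≢¬s)))
    where
      g : Fin m
      g = proj₁ fl
      fg : Flips s g f
      fg = proj₂ fl
      a : Fin m
      a = proj₁ (mid (not s))
      fa : Flips (not s) a e
      fa = proj₂ (mid (not s))
      g≢a : g ≢ a
      g≢a = rows-≢ A (proj₁ fg) (proj₁ fa)

      a-splits : Splits A s a e f
      a-splits = trans (proj₂ fa) (not-involutive s) , unflipped ¬fl′ (proj₁ fa)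
      g-splits : A r f ≢ not s → Splits A s g e f
      g-splits rf≢¬s = trans (agrees-off-flips mid fr fa g≢r g≢a) (proj₁ fg) , proj₂ fg
        where
          g≢r : g ≢ r
          g≢r refl = rf≢¬s (proj₂ fg)

  OneSided? : ∀ t f → Dec (OneSided t f)
  OneSided? t f = Flipped? t f ×-dec ¬? (Flipped? (not t) f)

  MidCol? : ∀ e → Dec (MidCol e)
  MidCol? e = Mid? e ⊎-dec (e ≟ c)

  column-cases : ∀ e → OneSided false e ⊎ MidCol e ⊎ OneSided true e
  column-cases e with Flipped? true e | Flipped? false e
  ... | yes ft | yes ff = inj₂ (inj₁ (inj₁ λ { true → ft ; false → ff }))
  ... | yes ft | no ¬ff = inj₂ (inj₂ (ft , ¬ff))
  ... | no ¬ft | yes ff = inj₁ (ff , ¬ft)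
  ... | no ¬ft | no ¬ff = inj₂ (inj₁ (inj₂ (unflipped⇒≡c ¬ft ¬ff)))

  left∩mid=∅ : ∀ {e} → OneSided false e → ¬ MidCol e
  left∩mid=∅ (_ , ¬ft) (inj₁ mid)  = ¬ft (mid true)
  left∩mid=∅ (ff , _)  (inj₂ refl) = c-unflipped false ff

  left∩right=∅ : ∀ {e} → OneSided false e → ¬ OneSided true e
  left∩right=∅ (_ , ¬ft) (ft , _) = ¬ft ft

  mid∩right=∅ : ∀ {e} → MidCol e → ¬ OneSided true e
  mid∩right=∅ (inj₁ mid)  (_ , ¬ff) = ¬ff (mid false)
  mid∩right=∅ (inj₂ refl) (ft , _)  = c-unflipped true ft

  leftCols : Enumeration (OneSided false)
  leftCols = enumerate (OneSided? false)

  midCols : Enumeration MidCol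
  midCols = enumerate MidCol?

  rightCols : Enumeration (OneSided true)
  rightCols = enumerate (OneSided? true)

  open Enumeration midCols using ()
    renaming ( size to l; at to midCol; sound to midCol-sound
             ; injective to midCol-injective; complete to midCol-complete)

  columns↔ : (Fin (Enumeration.size leftCols) ⊎ (Fin l ⊎ Fin (Enumeration.size rightCols))) ↔ Fin n
  columns↔ = partition↔ leftCols midCols rightCols left∩mid=∅ left∩right=∅ mid∩right=∅ column-cases

  module Matching (t : Bool) (z : Fin m) {d : Fin n} (mid-d : Mid d)
                  (z-flips : ∀ {e} → Mid e → Flips t z e) where

    partner : Fin n → Fin m
    partner e with Flipped? (not t) e
    ... | yes (r , _) = r
    ... | no _        = z

    partner-flips : ∀ {e} → Mid e → Flips (not t) (partner e) e
    partner-flips {e} mid with Flipped? (not t) e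
    ... | yes (_ , fr) = fr
    ... | no ¬fl       = contradiction (mid (not t)) ¬fl

    partner-c : partner c ≡ z
    partner-c with Flipped? (not t) c
    ... | yes fl = contradiction fl (c-unflipped (not t))
    ... | no _   = refl

    partner-diagonal : ∀ {e} → MidCol e → A (partner e) e ≡ t
    partner-diagonal (inj₁ mid)  = trans (proj₂ (partner-flips mid)) (not-involutive t)
    partner-diagonal (inj₂ refl) = trans (cong (λ r → A r c) partner-c) (proj₁ (z-flips mid-d))

    partner-off-diagonal : ∀ {e e′} → MidCol e → MidCol e′ → e ≢ e′ → A (partner e) e′ ≡ not t
    partner-off-diagonal (inj₂ refl) (inj₂ refl) e≢e′ = contradiction refl e≢e′
    partner-off-diagonal {e′ = e′} (inj₂ refl) (inj₁ mid′) _ =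
      trans (cong (λ r → A r e′) partner-c) (proj₂ (z-flips mid′))
    partner-off-diagonal (inj₁ mid) (inj₂ refl) _ = proj₁ (partner-flips mid)
    partner-off-diagonal {e} {e′} (inj₁ mid) (inj₁ mid′) e≢e′ =
      trans (agrees-off-flips mid′ (z-flips mid′) (partner-flips mid′) p≢z p≢p′) (proj₁ (partner-flips mid))
      where
        p≢z : partner e ≢ z
        p≢z = ≢-sym (rows-≢ A (proj₁ (z-flips mid)) (proj₁ (partner-flips mid)))
        p≢p′ : partner e ≢ partner e′
        p≢p′ eq = e≢e′ (same-flips⇒≡ mid mid′ (z-flips mid) (z-flips mid′) (partner-flips mid)
                          (subst (λ r → Flips (not t) r e′) (sym eq) (partner-flips mid′)))

    flip-row⇒partner : ∀ {s r e} → Mid e → Flips s r e → ∃ λ e′ → MidCol e′ × partner e′ ≡ r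
    flip-row⇒partner {e = e} mid fr with flip-rows mid (z-flips mid) (partner-flips mid) fr
    ... | inj₁ r≡z = c , inj₂ refl , trans partner-c (sym r≡z)
    ... | inj₂ r≡p = e , inj₁ mid , sym r≡p

    partner-on-one-sided : ∀ {s e f} → OneSided s f → MidCol e → A (partner e) f ≡ not s
    partner-on-one-sided os (inj₁ mid) = one-sided-on-flip-rows os mid (partner-flips mid)
    partner-on-one-sided {f = f} os (inj₂ refl) =
      trans (cong (λ r → A r f) partner-c) (one-sided-on-flip-rows os mid-d (z-flips mid-d))

    IsPartner : Fin m → Set
    IsPartner r = ∃ λ i → partner (midCol i) ≡ r

    TopRow BottomRow : Fin m → Set
    TopRow r    = A r c ≡ false × ¬ IsPartner r
    BottomRow r = A r c ≡ true × ¬ IsPartner r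

    partnerRows : Enumeration IsPartner
    partnerRows = record
      { size = l ; at = partner ∘ midCol ; injective = injective
      ; sound = λ i → i , refl ; complete = λ _ p → p }
      where
        injective : Injective _≡_ _≡_ (partner ∘ midCol)
        injective {i} {j} eq = decidable-stable (i ≟ j) λ i≢j → not-¬ refl (trans
          (sym (partner-diagonal (midCol-sound j)))
          (trans (cong (λ r → A r (midCol j)) (sym eq))
                 (partner-off-diagonal (midCol-sound i) (midCol-sound j)
                                       (i≢j ∘ midCol-injective))))

    IsPartner? : ∀ r → Dec (IsPartner r)
    IsPartner? r = any? λ i → partner (midCol i) ≟ r

    row-cases : ∀ r → TopRow r ⊎ IsPartner r ⊎ BottomRow r
    row-cases r with IsPartner? r | A r c
    ... | yes p | _     = inj₂ (inj₁ p)
    ... | no ¬p | false = inj₁ (refl , ¬p)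
    ... | no ¬p | true  = inj₂ (inj₂ (refl , ¬p))

    topRows : Enumeration TopRow
    topRows = enumerate λ r → (A r c ≟ᵇ false) ×-dec ¬? (IsPartner? r)

    bottomRows : Enumeration BottomRow
    bottomRows = enumerate λ r → (A r c ≟ᵇ true) ×-dec ¬? (IsPartner? r)

    rows↔ : (Fin (Enumeration.size topRows) ⊎ (Fin l ⊎ Fin (Enumeration.size bottomRows))) ↔ Fin m
    rows↔ = partition↔ topRows partnerRows bottomRows
      (λ top p → proj₂ top p) (λ top bot → not-¬ (proj₁ top) (proj₁ bot)) (λ p bot → proj₂ bot p)
      row-cases

    non-partner-agrees : ∀ {r e} → ¬ IsPartner r → MidCol e → A r e ≡ A r c
    non-partner-agrees         _  (inj₂ refl) = refl
    non-partner-agrees {r} {e} ¬p (inj₁ mid)  = decidable-stable (A r e ≟ᵇ A r c) λ re≢rc →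
      let e′ , mid′ , eq = flip-row⇒partner mid (flips-at re≢rc)
          i , i≡e′ = midCol-complete e′ mid′
      in ¬p (i , trans (cong partner i≡e′) eq)

    partner-entry : ∀ i j → A (partner (midCol i)) (midCol j) ≡ I-or-Ic t l i j
    partner-entry i j with i ≟ j
    ... | yes refl = trans (partner-diagonal (midCol-sound i)) (sym (I-or-Ic-diagonal t i))
    ... | no i≢j   = trans (partner-off-diagonal (midCol-sound i) (midCol-sound j) (i≢j ∘ midCol-injective))
                           (sym (I-or-Ic-off-diagonal t i≢j))

    2≤l : 2 ≤ l
    2≤l = ≢⇒2≤ (proj₁ c∈) (proj₁ d∈) λ i≡j →
      c≢d (trans (sym (proj₂ c∈)) (trans (cong midCol i≡j) (proj₂ d∈)))
      where
        c∈ : ∃ λ i → midCol i ≡ c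
        c∈ = midCol-complete c (inj₂ refl)
        d∈ : ∃ λ j → midCol j ≡ d
        d∈ = midCol-complete d (inj₁ mid-d)
        c≢d : c ≢ d
        c≢d refl = c-unflipped true (mid-d true)

    blockForm : BlockForm A
    blockForm = blockForm-of-partitions simple FT⊀A rows↔ columns↔ (I-or-Ic t l) (I-or-Ic-shape t l) 2≤l
      partner-entry
      (λ i j → trans (non-partner-agrees (proj₂ (top i)) (midCol-sound j)) (proj₁ (top i)))
      (λ i j → unflipped (proj₂ (right j)) (proj₁ (top i)))
      (λ i j → partner-on-one-sided (left j) (midCol-sound i))
      (λ i j → partner-on-one-sided (right j) (midCol-sound i))
      (λ i j → unflipped (proj₂ (left j)) (proj₁ (bottom i)))
      (λ i j → trans (non-partner-agrees (proj₂ (bottom i)) (midCol-sound j)) (proj₁ (bottom i)))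
      where
        open Enumeration topRows using () renaming (sound to top)
        open Enumeration bottomRows using () renaming (sound to bottom)
        open Enumeration leftCols using () renaming (sound to left)
        open Enumeration rightCols using () renaming (sound to right)

lemma2p2 : ∀ {m n} (A : Mat m n) → Simple A → ¬ (FT ≺ A) → I 2 ≺ A →
    Σ ℕ λ r₁ → Σ ℕ λ c₁ → Σ ℕ λ l → Σ ℕ λ r₃ → Σ ℕ λ c₃ →
    Σ (Mat r₁ c₁) λ A₁ → Σ (Mat l l) λ B → Σ (Mat r₃ c₃) λ A₂ →
    Σ (Permutation (r₁ + l + r₃) m) λ σ →
    Σ (Permutation (c₁ + l + c₃) n) λ τ →
      (∀ i j → A (σ ⟨$⟩ʳ i) (τ ⟨$⟩ʳ j) ≡ block A₁ B A₂ i j) ×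
      Simple A₁ × ¬ (FT ≺ A₁) × Simple A₂ × ¬ (FT ≺ A₂) ×
      (B ≡ I l ⊎ B ≡ Ic l) × 2 ≤ l
lemma2p2 {m} {n} A simple FT⊀A (rows , cols , _ , _ , entries) =
  [ Matching.blockForm true x mid-d , Matching.blockForm false y mid-d ]′
    (common-flip-row mid-d x-flips y-flips)
  where
    open Pivot simple FT⊀A (cols zero)
    x y : Fin m
    x = rows zero
    y = rows (suc zero)
    d : Fin n
    d = cols (suc zero)
    x-flips : Flips true x d
    x-flips = entries zero zero , entries zero (suc zero)
    y-flips : Flips false y d
    y-flips = entries (suc zero) zero , entries (suc zero) (suc zero)
    mid-d : Mid d
    mid-d true  = x , x-flips
    mid-d false = y , y-flips
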